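{- Let $\mathbf{O}$ be an appropriate class of operators. Suppose there exist an $\mathbf{O}$-representable function $C:\mathbb{N}^2\to\mathbb{N}$ and $\mathbf{O}$-representable functions $L,R:\mathbb{N}\to\mathbb{N}$ such that $$\{(u,v)\in\mathbb{N}^2\mid C(u,v)=0\}=\{(0,0)\},\qquad \{(L(s),R(s))\mid s\in\mathbb{N}\}=\mathbb{N}^2.$$ Then the substitution operation on real functions preserves conditional $\mathbf{O}$-computability: whenever $\theta_0:D_0\to\mathbb{R}$ with $D_0\subseteq\mathbb{R}^K$ and $\theta_1,\ldots,\theta_K:D_i\to\mathbb{R}$ with $D_i\subseteq\mathbb{R}^N$ are conditionally $\mathbf{O}$-computable, the function $\theta$ defined by $\theta(\bar\xi)=\theta_0(\theta_1(\bar\xi),\ldots,\theta_K(\bar\xi))$ (on the set of all $\bar\xi\in D_1\cap\cdots\cap D_K$ with $(\theta_1(\bar\xi),\ldots,\theta_K(\bar\xi))\in D_0$) is conditionally $\mathbf{O}$-computable.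
   Context: For $m\in\mathbb{N}$, $\mathbb{T}_m$ is the set of all total functions $\mathbb{N}^m\to\mathbb{N}$. For $k\in\mathbb{N}$, a $k$-ary operator is a mapping $\mathbb{T}_1^k\to\mathbb{T}_1$. For $c\in\mathbb{N}$, $\check{c}\in\mathbb{T}_1$ is the constant function with value $c$. A class $\mathbf{O}$ of operators is appropriate if: (1) for all $k$ and $i\in\{1,\ldots,k\}$ the $k$-ary operator $(f_1,\ldots,f_k)\mapsto f_i$ is in $\mathbf{O}$; (2) the binary operator $F(f_1,f_2)(n)=f_1(f_2(n))$ is in $\mathbf{O}$; (3) for all $k,l$, if $F$ is a $k$-ary operator in $\mathbf{O}$ and $G_1,\ldots,G_k$ are $l$-ary operators in $\mathbf{O}$, then $H(g_1,\ldots,g_l)=F(G_1(g_1,\ldots,g_l),\ldots,G_k(g_1,\ldots,g_l))$ is in $\mathbf{O}$; (4) for all $k$, if $F$ is a $(k+1)$-ary operator in $\mathbf{O}$, then $G(f_1,\ldots,f_k)(n)=F(f_1,\ldots,f_k,\check{n})(n)$ is in $\mathbf{O}$. For $f:\mathbb{N}^k\to\mathbb{N}$, $\mathring{f}$ is the $k$-ary operator $\mathring{f}(f_1,\ldots,f_k)(n)=f(f_1(n),\ldots,f_k(n))$, and $f$ is $\mathbf{O}$-representable if $\mathring{f}\in\mathbf{O}$. A triple $(f,g,h)\in\mathbb{T}_1^3$ names $\xi\in\mathbb{R}$ if $\left|\frac{f(t)-g(t)}{h(t)+1}-\xi\right|<\frac{1}{t+1}$ for all $t\in\mathbb{N}$.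 A function $\theta:D\to\mathbb{R}$, $D\subseteq\mathbb{R}^N$, is conditionally $\mathbf{O}$-computable if there exist a $3N$-ary operator $E$ and $(3N+1)$-ary operators $F,G,H$, all in $\mathbf{O}$, such that whenever $(\xi_1,\ldots,\xi_N)\in D$ and $(f_j,g_j,h_j)$ names $\xi_j$ for $j=1,\ldots,N$: (a) there is $s\in\mathbb{N}$ with $E(f_1,g_1,h_1,\ldots,f_N,g_N,h_N)(s)=0$; (b) for every such $s$, the triple $(F(\bar f,\check{s}),G(\bar f,\check{s}),H(\bar f,\check{s}))$, where $\bar f=(f_1,g_1,h_1,\ldots,f_N,g_N,h_N)$, names $\theta(\xi_1,\ldots,\xi_N)$. -}

module Defs where

open import Data.Nat using (ℕ; zero; suc; _*_)
open import Data.Fin using (Fin; zero; suc)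
open import Data.Integer as ℤ using (ℤ; +_)
open import Data.Rational using (ℚ; _/_; _-_; _+_; _<_; _≤_; ∣_∣)
open import Data.Product using (Σ; ∃; _×_; _,_)
open import Relation.Binary.PropositionalEquality using (_≡_)

T₁ : Set
T₁ = ℕ → ℕ

Op : ℕ → Set
Op k = (Fin k → T₁) → T₁

check : ℕ → T₁
check c _ = c

snoc : ∀ {A : Set} {k : ℕ} → (Fin k → A) → A → Fin (suc k) → A
snoc {k = zero}  v a zero    = a
snoc {k = suc k} v a zero    = v zero
snoc {k = suc k} v a (suc i) = snoc (λ j → v (suc j)) a i

OpClass : Set₁
OpClass = (k : ℕ) → Op k → Set

record Appropriate (O : OpClass) : Set where
  field
    proj : ∀ k (i : Fin k) → O k (λ fs → fs i)
    comp : O 2 (λ fs n → fs zero (fs (suc zero) n))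
    subst : ∀ k l (F : Op k) (Gs : Fin k → Op l) →
            O k F → (∀ i → O l (Gs i)) →
            O l (λ gs → F (λ i → Gs i gs))
    diag : ∀ k (F : Op (suc k)) → O (suc k) F →
           O k (λ fs n → F (snoc fs (check n)) n)
    -- Set-theoretic extensionality (automatic when operators are
    -- set-theoretic mappings):
    -- membership depends only on the operator's graph
    ext-closed : ∀ k (F G : Op k) → O k F →
                 (∀ fs n → F fs n ≡ G fs n) → O k G
    ext-args : ∀ k (F : Op k) → O k F → ∀ (fs gs : Fin k → T₁) →
               (∀ i n → fs i n ≡ gs i n) → ∀ n → F fs n ≡ F gs n

ring : ∀ {k} → ((Fin k → ℕ) → ℕ) → Op k
ring f fs n = f (λ i → fs i n)

Representable : OpClass → (k : ℕ) → ((Fin k → ℕ) → ℕ) → Set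
Representable O k f = O k (ring f)

-- Real numbers (Bishop regular Cauchy sequences of rationals)

record ℝ : Set where
  field
    seq : ℕ → ℚ
    reg : ∀ m n → ∣ seq m - seq n ∣ ≤ (+ 1 / suc m) + (+ 1 / suc n)
open ℝ public

-- |q - ξ| < ε  for rational q, ε and real ξ
-- (Bishop's strict order, unfolded: some approximation x_n of ξ
--  satisfies |q - x_n| + 2/(n+1) < ε)
AbsDiffLt : ℚ → ℝ → ℚ → Set
AbsDiffLt q ξ ε = ∃ λ n → ∣ q - seq ξ n ∣ + (+ 2 / suc n) < ε

Names : T₁ → T₁ → T₁ → ℝ → Set
Names f g h ξ = ∀ t →
  AbsDiffLt (((+ f t) ℤ.- (+ g t)) / suc (h t)) ξ (+ 1 / suc t)

interleave : ∀ {N} → (Fin N → T₁) → (Fin N → T₁) → (Fin N → T₁) →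
             Fin (N * 3) → T₁
interleave {zero}  fs gs hs ()
interleave {suc N} fs gs hs zero = fs zero
interleave {suc N} fs gs hs (suc zero) = gs zero
interleave {suc N} fs gs hs (suc (suc zero)) = hs zero
interleave {suc N} fs gs hs (suc (suc (suc i))) =
  interleave (λ j → fs (suc j)) (λ j → gs (suc j)) (λ j → hs (suc j)) i

-- conditional O-computability of θ : D → ℝ, D ⊆ ℝ^N
-- (D as a predicate, θ taking a membership proof)
CondComputable : OpClass → (N : ℕ) → (D : (Fin N → ℝ) → Set) →
                 ((ξ : Fin N → ℝ) → D ξ → ℝ) → Set
CondComputable O N D θ =
  Σ (Op (N * 3)) λ E → Σ (Op (suc (N * 3))) λ F →
  Σ (Op (suc (N * 3))) λ G → Σ (Op (suc (N * 3))) λ H →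
  O (N * 3) E × O (suc (N * 3)) F × O (suc (N * 3)) G × O (suc (N * 3)) H ×
  (∀ (ξ : Fin N → ℝ) (d : D ξ) (fs gs hs : Fin N → T₁) →
     (∀ j → Names (fs j) (gs j) (hs j) (ξ j)) →
     let f̄ = interleave fs gs hs in
     (∃ λ s → E f̄ s ≡ 0) ×
     (∀ s → E f̄ s ≡ 0 →
        Names (F (snoc f̄ (check s))) (G (snoc f̄ (check s)))
              (H (snoc f̄ (check s))) (θ ξ d)))

module Submission where

-- Let (E₀,F₀,G₀,H₀) compute θ₀ and (Eᵢ,Fᵢ,Gᵢ,Hᵢ) compute θᵢ (i < K).  Feeding
-- the inputs f̄ together with a search index uᵢ into Fᵢ,Gᵢ,Hᵢ yields a name
-- of θᵢ(ξ) as soon as Eᵢ(f̄)(uᵢ) = 0; interleaving these names and feeding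
-- them with a further index t₀ into F₀,G₀,H₀ yields a name of θ(ξ) as soon
-- as E₀(names)(t₀) = 0.  A single search index s encodes the whole tuple
-- (t₀,u₁,…,u_K) through the pairing functions L, R, and the K+1 halting
-- tests are merged into one by iterating C, whose only zero is (0,0).

open import Defs
open import Data.Nat using (ℕ; zero; suc; _*_)
open import Data.Fin using (Fin; zero; suc; fromℕ; inject₁)
open import Data.Product using (Σ; ∃; _×_; _,_; proj₁; proj₂)
open import Data.Vec.Functional using (_∷_)
open import Function using (_∘_)
open import Function.Bundles using (_⇔_; Equivalence)
open import Relation.Binary.PropositionalEquality
  using (_≡_; _≗_; refl; sym; trans; cong; cong-app)

_≈ₜ_ : ∀ {k} → (Fin k → T₁) → (Fin k → T₁) → Set
fs ≈ₜ gs = ∀ i → fs i ≗ gs i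

snoc-last : ∀ {A : Set} {k} (v : Fin k → A) (a : A) → snoc v a (fromℕ k) ≡ a
snoc-last {k = zero}  v a = refl
snoc-last {k = suc k} v a = snoc-last (v ∘ suc) a

snoc-init : ∀ {A : Set} {k} (v : Fin k → A) (a : A) (j : Fin k) →
            snoc v a (inject₁ j) ≡ v j
snoc-init {k = suc k} v a zero    = refl
snoc-init {k = suc k} v a (suc j) = snoc-init (v ∘ suc) a j

snoc-closed : ∀ {X A : Set} (P : (X → A) → Set) {k}
              (v : X → Fin k → A) (a : X → A) →
              (∀ j → P (λ x → v x j)) → P a →
              ∀ j → P (λ x → snoc (v x) (a x) j)
snoc-closed P {zero}  v a pv pa zero    = pa
snoc-closed P {suc k} v a pv pa zero    = pv zero
snoc-closed P {suc k} v a pv pa (suc j) =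
  snoc-closed P (λ x i → v x (suc i)) a (pv ∘ suc) pa j

snoc-cong : ∀ {k} {v w : Fin k → T₁} {a b : T₁} →
            v ≈ₜ w → a ≗ b → snoc v a ≈ₜ snoc w b
snoc-cong {zero}  ev ea zero    = ea
snoc-cong {suc k} ev ea zero    = ev zero
snoc-cong {suc k} ev ea (suc j) = snoc-cong (ev ∘ suc) ea j

interleave-closed : ∀ {X : Set} (P : (X → T₁) → Set) {N}
                    (fs gs hs : X → Fin N → T₁) →
                    (∀ i → P (λ x → fs x i)) → (∀ i → P (λ x → gs x i)) →
                    (∀ i → P (λ x → hs x i)) →
                    ∀ j → P (λ x → interleave (fs x) (gs x) (hs x) j)
interleave-closed P {suc N} fs gs hs pf pg ph zero             = pf zero
interleave-closed P {suc N} fs gs hs pf pg ph (suc zero)       = pg zero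
interleave-closed P {suc N} fs gs hs pf pg ph (suc (suc zero)) = ph zero
interleave-closed P {suc N} fs gs hs pf pg ph (suc (suc (suc j))) =
  interleave-closed P (λ x i → fs x (suc i)) (λ x i → gs x (suc i))
    (λ x i → hs x (suc i)) (pf ∘ suc) (pg ∘ suc) (ph ∘ suc) j

interleave-cong : ∀ {N} {fs gs hs fs′ gs′ hs′ : Fin N → T₁} →
                  fs ≈ₜ fs′ → gs ≈ₜ gs′ → hs ≈ₜ hs′ →
                  interleave fs gs hs ≈ₜ interleave fs′ gs′ hs′
interleave-cong {suc N} ef eg eh zero             = ef zero
interleave-cong {suc N} ef eg eh (suc zero)       = eg zero
interleave-cong {suc N} ef eg eh (suc (suc zero)) = eh zero
interleave-cong {suc N} ef eg eh (suc (suc (suc j))) =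
  interleave-cong (ef ∘ suc) (eg ∘ suc) (eh ∘ suc) j

Names-cong : ∀ {f g h f′ g′ h′ : T₁} {ξ : ℝ} →
             f ≗ f′ → g ≗ g′ → h ≗ h′ → Names f g h ξ → Names f′ g′ h′ ξ
Names-cong ef eg eh named t rewrite sym (ef t) | sym (eg t) | sym (eh t) =
  named t

at : ∀ {k} → (Fin k → T₁) → ℕ → Fin (suc k) → T₁
at f̄ s = snoc f̄ (check s)

record Code (O : OpClass) (N : ℕ) (D : (Fin N → ℝ) → Set)
            (θ : (ξ : Fin N → ℝ) → D ξ → ℝ) : Set where
  field
    E     : Op (N * 3)
    F G H : Op (suc (N * 3))
    E∈    : O (N * 3) E
    F∈    : O (suc (N * 3)) F
    G∈    : O (suc (N * 3)) G
    H∈    : O (suc (N * 3)) H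
    spec  : ∀ (ξ : Fin N → ℝ) (d : D ξ) (fs gs hs : Fin N → T₁) →
            (∀ j → Names (fs j) (gs j) (hs j) (ξ j)) →
            let f̄ = interleave fs gs hs in
            (∃ λ s → E f̄ s ≡ 0) ×
            (∀ s → E f̄ s ≡ 0 →
               Names (F (at f̄ s)) (G (at f̄ s)) (H (at f̄ s)) (θ ξ d))

module _ {O : OpClass} {N : ℕ} {D : (Fin N → ℝ) → Set}
         {θ : (ξ : Fin N → ℝ) → D ξ → ℝ} where

  fromCondComputable : CondComputable O N D θ → Code O N D θ
  fromCondComputable (E , F , G , H , E∈ , F∈ , G∈ , H∈ , spec) =
    record { E = E ; F = F ; G = G ; H = H
           ; E∈ = E∈ ; F∈ = F∈ ; G∈ = G∈ ; H∈ = H∈ ; spec = spec }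

  toCondComputable : Code O N D θ → CondComputable O N D θ
  toCondComputable c = E , F , G , H , E∈ , F∈ , G∈ , H∈ , spec
    where open Code c

module Closure {O : OpClass} (A : Appropriate O) where
  open Appropriate A

  respects : ∀ {k} {P : Op k} → O k P → ∀ {fs gs} → fs ≈ₜ gs → P fs ≗ P gs
  respects P∈ e = ext-args _ _ P∈ _ _ e

  plug : ∀ {m l} {P : Op m} (Qs : (Fin l → T₁) → Fin m → T₁) → O m P →
         (∀ j → O l (λ gs → Qs gs j)) → O l (λ gs → P (Qs gs))
  plug {m} {l} {P} Qs P∈ Qs∈ = subst m l P (λ j gs → Qs gs j) P∈ Qs∈

  ⟨_,_⟩ : T₁ → T₁ → Fin 2 → T₁
  ⟨ f , g ⟩ zero       = f
  ⟨ f , g ⟩ (suc zero) = g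

  plug₂ : ∀ {l} {B : Op 2} {P Q : Op l} →
          O 2 B → O l P → O l Q → O l (λ gs → B ⟨ P gs , Q gs ⟩)
  plug₂ {P = P} {Q} B∈ P∈ Q∈ =
    plug (λ gs → ⟨ P gs , Q gs ⟩) B∈ λ { zero → P∈ ; (suc zero) → Q∈ }

  compose : ∀ {l} {P Q : Op l} → O l P → O l Q → O l (λ gs n → P gs (Q gs n))
  compose = plug₂ comp

  apply₁ : ∀ {l} {φ : ℕ → ℕ} {P : Op l} →
           Representable O 1 (λ v → φ (v zero)) → O l P →
           O l (λ gs n → φ (P gs n))
  apply₁ {P = P} φ∈ P∈ = plug (λ gs _ → P gs) φ∈ (λ _ → P∈)

  apply₂ : ∀ {l} {ψ : ℕ → ℕ → ℕ} {P Q : Op l} →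
           Representable O 2 (λ v → ψ (v zero) (v (suc zero))) →
           O l P → O l Q → O l (λ gs n → ψ (P gs n) (Q gs n))
  apply₂ = plug₂

module TupleCode (L R : ℕ → ℕ) where

  component : (m : ℕ) → Fin (suc m) → ℕ → ℕ
  component m       zero    s = L s
  component (suc m) (suc i) s = component m i (R s)

  component-onto : (∀ u v → ∃ λ s → (L s ≡ u) × (R s ≡ v)) →
                   ∀ m (t : Fin (suc m) → ℕ) →
                   ∃ λ s → ∀ i → component m i s ≡ t i
  component-onto onto zero t with onto (t zero) 0
  ... | s , Ls , _ = s , λ { zero → Ls }
  component-onto onto (suc m) t with component-onto onto m (t ∘ suc)
  ... | s′ , codes-tail with onto (t zero) s′
  ... | s , Ls , Rs =
    s , λ { zero → Ls ; (suc i) → trans (cong (component m i) Rs) (codes-tail i) }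

module ZeroTest (C : ℕ → ℕ → ℕ) where

  allZero : (m : ℕ) → (Fin (suc m) → ℕ) → ℕ
  allZero zero    v = v zero
  allZero (suc m) v = C (v zero) (allZero m (v ∘ suc))

  module _ (C-zero : ∀ u v → (C u v ≡ 0) ⇔ ((u ≡ 0) × (v ≡ 0))) where

    allZero-sound : ∀ m v → allZero m v ≡ 0 → ∀ i → v i ≡ 0
    allZero-sound zero    v e zero    = e
    allZero-sound (suc m) v e zero    = proj₁ (Equivalence.to (C-zero _ _) e)
    allZero-sound (suc m) v e (suc i) =
      allZero-sound m (v ∘ suc) (proj₂ (Equivalence.to (C-zero _ _) e)) i

    allZero-complete : ∀ m v → (∀ i → v i ≡ 0) → allZero m v ≡ 0
    allZero-complete zero    v z = z zero
    allZero-complete (suc m) v z =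
      Equivalence.from (C-zero _ _) (z zero , allZero-complete m (v ∘ suc) (z ∘ suc))

module Substitution
  {O : OpClass} (A : Appropriate O)
  {C : ℕ → ℕ → ℕ} {L R : ℕ → ℕ}
  (C∈ : Representable O 2 (λ v → C (v zero) (v (suc zero))))
  (L∈ : Representable O 1 (λ v → L (v zero)))
  (R∈ : Representable O 1 (λ v → R (v zero)))
  (C-zero : ∀ u v → (C u v ≡ 0) ⇔ ((u ≡ 0) × (v ≡ 0)))
  (LR-onto : ∀ u v → ∃ λ s → (L s ≡ u) × (R s ≡ v)) where

  open Appropriate A using (proj; diag)
  open Closure A
  open TupleCode L R
  open ZeroTest C

  component-closed : ∀ m i {l} {P : Op l} → O l P →
                     O l (λ gs n → component m i (P gs n))
  component-closed m       zero    P∈ = apply₁ {φ = L} L∈ P∈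
  component-closed (suc m) (suc i) P∈ = component-closed m i (apply₁ {φ = R} R∈ P∈)

  allZero-closed : ∀ m {l} (Ps : (Fin l → T₁) → ℕ → Fin (suc m) → ℕ) →
                   (∀ j → O l (λ gs n → Ps gs n j)) →
                   O l (λ gs n → allZero m (Ps gs n))
  allZero-closed zero    Ps Ps∈ = Ps∈ zero
  allZero-closed (suc m) Ps Ps∈ =
    apply₂ {ψ = C} C∈ (Ps∈ zero) (allZero-closed m (λ gs n → Ps gs n ∘ suc) (Ps∈ ∘ suc))

  module Composite
    {K N : ℕ}
    {D₀ : (Fin K → ℝ) → Set} {θ₀ : (η : Fin K → ℝ) → D₀ η → ℝ}
    {Ds : Fin K → (Fin N → ℝ) → Set}
    {θs : (i : Fin K) → (ξ : Fin N → ℝ) → Ds i ξ → ℝ}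
    (outer : Code O K D₀ θ₀) (inner : ∀ i → Code O N (Ds i) (θs i)) where

    open Code

    -- Arguments (f̄, p) of the new F, G, H: inputs and a parameter function.
    Args : Set
    Args = Fin (suc (N * 3)) → T₁

    input : Args → Fin (N * 3) → T₁
    input as j = as (inject₁ j)

    -- Search index 0 is for the outer code, index i+1 for the i-th inner one.
    index : Fin (suc K) → Args → T₁
    index j as n = component K j (as (fromℕ (N * 3)) n)

    innerArgs : Fin K → Args → Fin (suc (N * 3)) → T₁
    innerArgs i as = snoc (input as) (index (suc i) as)

    innerNames : Args → Fin (K * 3) → T₁
    innerNames as = interleave (λ i → F (inner i) (innerArgs i as))
                               (λ i → G (inner i) (innerArgs i as))
                               (λ i → H (inner i) (innerArgs i as))

    outerArgs : Args → Fin (suc (K * 3)) → T₁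
    outerArgs as = snoc (innerNames as) (index zero as)

    tests : Args → ℕ → Fin (suc K) → ℕ
    tests as n zero    = E outer (innerNames as) (index zero as n)
    tests as n (suc i) = E (inner i) (input as) (index (suc i) as n)

    E′ : Op (N * 3)
    E′ f̄ s = allZero K (tests (at f̄ s) s)

    F′ G′ H′ : Op (suc (N * 3))
    F′ as = F outer (outerArgs as)
    G′ as = G outer (outerArgs as)
    H′ as = H outer (outerArgs as)

    index∈ : ∀ j → O (suc (N * 3)) (index j)
    index∈ j = component-closed K j (proj _ (fromℕ (N * 3)))

    input∈ : ∀ j → O (suc (N * 3)) (λ as → input as j)
    input∈ j = proj _ (inject₁ j)

    innerNames∈ : ∀ j → O (suc (N * 3)) (λ as → innerNames as j)
    innerNames∈ = interleave-closed (O _)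
      (λ as i → F (inner i) (innerArgs i as)) (λ as i → G (inner i) (innerArgs i as))
      (λ as i → H (inner i) (innerArgs i as))
      (λ i → plug (innerArgs i) (F∈ (inner i)) (innerArgs∈ i))
      (λ i → plug (innerArgs i) (G∈ (inner i)) (innerArgs∈ i))
      (λ i → plug (innerArgs i) (H∈ (inner i)) (innerArgs∈ i))
      where
      innerArgs∈ : ∀ i j → O (suc (N * 3)) (λ as → innerArgs i as j)
      innerArgs∈ i = snoc-closed (O _) input (index (suc i)) input∈ (index∈ (suc i))

    outerArgs∈ : ∀ j → O (suc (N * 3)) (λ as → outerArgs as j)
    outerArgs∈ = snoc-closed (O _) innerNames (index zero) innerNames∈ (index∈ zero)

    tests∈ : ∀ j → O (suc (N * 3)) (λ as n → tests as n j)
    tests∈ zero    = compose (plug innerNames (E∈ outer) innerNames∈) (index∈ zero)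
    tests∈ (suc i) = compose (plug input (E∈ (inner i)) input∈) (index∈ (suc i))

    -- The intended values at (f̄, š) when s codes (t₀, u₁,…,u_K): the inner
    -- names computed with indices uᵢ, and the tests with indices t₀, uᵢ.
    namesAt : (Fin (N * 3) → T₁) → (Fin K → ℕ) → Fin (K * 3) → T₁
    namesAt f̄ u = interleave (λ i → F (inner i) (at f̄ (u i)))
                             (λ i → G (inner i) (at f̄ (u i)))
                             (λ i → H (inner i) (at f̄ (u i)))

    testsAt : (Fin (N * 3) → T₁) → ℕ → (Fin K → ℕ) → Fin (suc K) → ℕ
    testsAt f̄ t₀ u zero    = E outer (namesAt f̄ u) t₀
    testsAt f̄ t₀ u (suc i) = E (inner i) f̄ (u i)

    module Evaluation (f̄ : Fin (N * 3) → T₁) (s t₀ : ℕ) (u : Fin K → ℕ)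
                      (decodes : ∀ j → component K j s ≡ (t₀ ∷ u) j) where

      input-at : input (at f̄ s) ≈ₜ f̄
      input-at j = cong-app (snoc-init f̄ (check s) j)

      index-at : ∀ j → index j (at f̄ s) ≗ check ((t₀ ∷ u) j)
      index-at j n =
        trans (cong (component K j) (cong-app (snoc-last f̄ (check s)) n)) (decodes j)

      innerNames-at : innerNames (at f̄ s) ≈ₜ namesAt f̄ u
      innerNames-at = interleave-cong
        (λ i → respects (F∈ (inner i)) (innerArgs-at i))
        (λ i → respects (G∈ (inner i)) (innerArgs-at i))
        (λ i → respects (H∈ (inner i)) (innerArgs-at i))
        where
        innerArgs-at : ∀ i → innerArgs i (at f̄ s) ≈ₜ at f̄ (u i)
        innerArgs-at i = snoc-cong input-at (index-at (suc i))

      tests-at : ∀ j → tests (at f̄ s) s j ≡ testsAt f̄ t₀ u j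
      tests-at zero = trans (cong (E outer (innerNames (at f̄ s))) (index-at zero s))
                            (respects (E∈ outer) innerNames-at t₀)
      tests-at (suc i) = trans (cong (E (inner i) (input (at f̄ s))) (index-at (suc i) s))
                               (respects (E∈ (inner i)) input-at (u i))

      outerArgs-at : outerArgs (at f̄ s) ≈ₜ at (namesAt f̄ u) t₀
      outerArgs-at = snoc-cong innerNames-at (index-at zero)

    module _ (ξ : Fin N → ℝ) (ds : ∀ i → Ds i ξ) (d₀ : D₀ (λ i → θs i ξ (ds i)))
             (fs gs hs : Fin N → T₁)
             (named : ∀ j → Names (fs j) (gs j) (hs j) (ξ j)) where

      f̄ : Fin (N * 3) → T₁
      f̄ = interleave fs gs hs

      namesAt-named : (u : Fin K → ℕ) → (∀ i → E (inner i) f̄ (u i) ≡ 0) →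
                      ∀ i → Names (F (inner i) (at f̄ (u i))) (G (inner i) (at f̄ (u i)))
                                  (H (inner i) (at f̄ (u i))) (θs i ξ (ds i))
      namesAt-named u z i = proj₂ (Code.spec (inner i) ξ (ds i) fs gs hs named) (u i) (z i)

      outerSpec : (u : Fin K → ℕ) → (∀ i → E (inner i) f̄ (u i) ≡ 0) →
                  (∃ λ t₀ → E outer (namesAt f̄ u) t₀ ≡ 0) ×
                  (∀ t₀ → E outer (namesAt f̄ u) t₀ ≡ 0 →
                     Names (F outer (at (namesAt f̄ u) t₀)) (G outer (at (namesAt f̄ u) t₀))
                           (H outer (at (namesAt f̄ u) t₀)) (θ₀ (λ i → θs i ξ (ds i)) d₀))
      outerSpec u z = Code.spec outer (λ i → θs i ξ (ds i)) d₀
        (λ i → F (inner i) (at f̄ (u i))) (λ i → G (inner i) (at f̄ (u i)))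
        (λ i → H (inner i) (at f̄ (u i))) (namesAt-named u z)

      -- A passing candidate exists: code the passing indices of all codes.
      E′-halts : ∃ λ s → E′ f̄ s ≡ 0
      E′-halts = s , allZero-complete C-zero K _ λ j →
          trans (Evaluation.tests-at f̄ s t₀ u decodes j) (passes j)
        where
        u : Fin K → ℕ
        u i = proj₁ (proj₁ (Code.spec (inner i) ξ (ds i) fs gs hs named))
        u-passes : ∀ i → E (inner i) f̄ (u i) ≡ 0
        u-passes i = proj₂ (proj₁ (Code.spec (inner i) ξ (ds i) fs gs hs named))
        t₀ = proj₁ (proj₁ (outerSpec u u-passes))
        passes : ∀ j → testsAt f̄ t₀ u j ≡ 0
        passes zero    = proj₂ (proj₁ (outerSpec u u-passes))
        passes (suc i) = u-passes i
        s = proj₁ (component-onto LR-onto K (t₀ ∷ u))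
        decodes = proj₂ (component-onto LR-onto K (t₀ ∷ u))

      -- A passing candidate decodes to passing indices for every code.
      E′-names : ∀ s → E′ f̄ s ≡ 0 →
                 Names (F′ (at f̄ s)) (G′ (at f̄ s)) (H′ (at f̄ s))
                       (θ₀ (λ i → θs i ξ (ds i)) d₀)
      E′-names s halted =
        Names-cong {ξ = θ₀ (λ i → θs i ξ (ds i)) d₀}
                   (λ n → sym (respects (F∈ outer) outerArgs-at n))
                   (λ n → sym (respects (G∈ outer) outerArgs-at n))
                   (λ n → sym (respects (H∈ outer) outerArgs-at n))
                   (proj₂ (outerSpec u (λ i → passes (suc i))) t₀ (passes zero))
        where
        t₀ = component K zero s
        u : Fin K → ℕ
        u i = component K (suc i) s
        decodes : ∀ j → component K j s ≡ (t₀ ∷ u) j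
        decodes zero    = refl
        decodes (suc i) = refl
        open Evaluation f̄ s t₀ u decodes using (tests-at; outerArgs-at)
        passes : ∀ j → testsAt f̄ t₀ u j ≡ 0
        passes j = trans (sym (tests-at j)) (allZero-sound C-zero K _ halted j)

    composite : Code O N (λ ξ → Σ (∀ i → Ds i ξ) λ ds → D₀ (λ i → θs i ξ (ds i)))
                         (λ ξ d → θ₀ (λ i → θs i ξ (proj₁ d i)) (proj₂ d))
    composite = record
      { E = E′ ; F = F′ ; G = G′ ; H = H′
      ; E∈ = diag _ _ (allZero-closed K tests tests∈)
      ; F∈ = plug outerArgs (F∈ outer) outerArgs∈
      ; G∈ = plug outerArgs (G∈ outer) outerArgs∈
      ; H∈ = plug outerArgs (H∈ outer) outerArgs∈
      ; spec = λ { ξ (ds , d₀) fs gs hs named →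
                   E′-halts ξ ds d₀ fs gs hs named , E′-names ξ ds d₀ fs gs hs named }
      }

theorem1 : (O : OpClass) → Appropriate O →
    (C : ℕ → ℕ → ℕ) (L R : ℕ → ℕ) →
    Representable O 2 (λ v → C (v zero) (v (suc zero))) →
    Representable O 1 (λ v → L (v zero)) →
    Representable O 1 (λ v → R (v zero)) →
    (∀ u v → (C u v ≡ 0) ⇔ ((u ≡ 0) × (v ≡ 0))) →
    (∀ u v → ∃ λ s → (L s ≡ u) × (R s ≡ v)) →
    (K N : ℕ) →
    (D₀ : (Fin K → ℝ) → Set) (θ₀ : (η : Fin K → ℝ) → D₀ η → ℝ) →
    (Ds : Fin K → (Fin N → ℝ) → Set) →
    (θs : (i : Fin K) → (ξ : Fin N → ℝ) → Ds i ξ → ℝ) →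
    CondComputable O K D₀ θ₀ →
    (∀ i → CondComputable O N (Ds i) (θs i)) →
    CondComputable O N
      (λ ξ → Σ (∀ i → Ds i ξ) λ ds → D₀ (λ i → θs i ξ (ds i)))
      (λ ξ d → θ₀ (λ i → θs i ξ (proj₁ d i)) (proj₂ d))
theorem1 O A C L R C∈ L∈ R∈ C-zero LR-onto K N D₀ θ₀ Ds θs c₀ cs =
  toCondComputable (Composite.composite {θ₀ = θ₀} {θs = θs}
                      (fromCondComputable c₀) (λ i → fromCondComputable (cs i)))
  where open Substitution A C∈ L∈ R∈ C-zero LR-onto
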